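{- Let $z_1,z_2,z_3$ be distinct points of $\mathbb{Z}^2$ and let $\Delta=d_3(z_1,z_2,z_3)$. Write ${\cal R}_1={\cal R}(z_1,z_2)$, ${\cal R}_2={\cal R}(z_1,z_3)$, ${\cal R}_3={\cal R}(z_2,z_3)$. Then $$\{z\in\mathbb{Z}^2: d_4(z_1,z_2,z_3,z)\le\Delta\}=({\cal R}_1\cap{\cal R}_2)\cup({\cal R}_1\cap{\cal R}_3)\cup({\cal R}_2\cap{\cal R}_3).$$
   Context: The grid graph ${\cal G}_2$ has vertex set $\mathbb{Z}^2$, with $z,z'$ adjacent iff their $L_1$-distance is $1$. The tristance $d_3$ (resp. quadristance $d_4$) of three (resp. four) points of $\mathbb{Z}^2$ is the minimum number of edges of a tree in ${\cal G}_2$ (possibly using additional vertices) containing them. For $u=(u_1,u_2),w=(w_1,w_2)\in\mathbb{Z}^2$, the bounding rectangle ${\cal R}(u,w)$ is $\{(x,y)\in\mathbb{Z}^2:\min\{u_1,w_1\}\le x\le\max\{u_1,w_1\},\ \min\{u_2,w_2\}\le y\le\max\{u_2,w_2\}\}$. -}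

module Defs where

open import Data.Nat using (ℕ; zero; suc; _≤_)
open import Data.Integer as ℤ using (ℤ; _-_; ∣_∣; _⊓_; _⊔_)
open import Data.Product using (_×_; _,_; Σ; ∃)
open import Data.List using (List; []; _∷_; [_])
open import Data.List.Membership.Propositional using (_∈_; _∉_)
open import Data.List.Relation.Unary.All using (All)
open import Relation.Binary.PropositionalEquality using (_≡_)

Point : Set
Point = ℤ × ℤ

Adj : Point → Point → Set
Adj (x₁ , y₁) (x₂ , y₂) = ∣ x₁ - x₂ ∣ Data.Nat.+ ∣ y₁ - y₂ ∣ ≡ 1
  where import Data.Nat

-- Finite subtrees of 𝒢₂, built by repeatedly attaching a new leaf.
-- GridTree V k : there is a tree in 𝒢₂ with vertex list V and k edges.
data GridTree : List Point → ℕ → Set where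
  single : (p : Point) → GridTree [ p ] 0
  grow   : ∀ {V k} → GridTree V k →
           ∀ {v w} → v ∈ V → Adj v w → w ∉ V →
           GridTree (w ∷ V) (suc k)

IsSteinerDist : List Point → ℕ → Set
IsSteinerDist S d =
  (Σ (List Point) λ V → GridTree V d × All (_∈ V) S) ×
  (∀ V k → GridTree V k → All (_∈ V) S → d ≤ k)

IsTristance : Point → Point → Point → ℕ → Set
IsTristance a b c d = IsSteinerDist (a ∷ b ∷ c ∷ []) d

IsQuadristance : Point → Point → Point → Point → ℕ → Set
IsQuadristance a b c e d = IsSteinerDist (a ∷ b ∷ c ∷ e ∷ []) d

InRect : Point → Point → Point → Set
InRect (u₁ , u₂) (w₁ , w₂) (x , y) =
  (u₁ ⊓ w₁ ℤ.≤ x × x ℤ.≤ u₁ ⊔ w₁) × (u₂ ⊓ w₂ ℤ.≤ y × y ℤ.≤ u₂ ⊔ w₂)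

-- In each coordinate three terminals span an interval, and the tristance is the half-perimeter
-- (sum over the coordinates of max − min) of their bounding box.  Peeling leaves off a grid tree with
-- k edges shows that any four of its vertices admit an H-shaped configuration (two pairs of terminals
-- joined to junctions p and q) of ℓ¹-length at most k, and that length splits into two one-dimensional
-- H-lengths.  If z lies in two of the rectangles, say ℛ(z₁,z₂) ∩ ℛ(z₁,z₃), the path z₁ → z → m
-- branching to z₂ and z₃, with m the coordinatewise median, has exactly the half-perimeter as length.
-- Otherwise, whichever terminal zᵢ the H pairs with z, in some coordinate z is not between zᵢ and both
-- remaining terminals; there the one-dimensional H-length strictly exceeds the range, so d₄ > Δ.
module Submission where

open import Defs
open import Data.Nat using (ℕ; _≤_)
open import Data.Product using (_×_)
open import Data.Sum using (_⊎_)
open import Relation.Binary.PropositionalEquality using (_≢_)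
open import Function.Bundles using (_⇔_)

import Algebra.Properties.CommutativeSemigroup as CommSemigroupProperties
open import Data.Empty using (⊥-elim)
open import Data.Integer as ℤ using (ℤ; _-_; ∣_∣)
import Data.Integer.Properties as ℤₚ
import Data.Integer.Tactic.RingSolver as ℤ-Solver
open import Data.List using (List; []; _∷_)
open import Data.List.Membership.Propositional using (_∈_)
open import Data.List.Relation.Binary.Permutation.Propositional using (↭-refl; ↭-swap)
open import Data.List.Relation.Binary.Permutation.Propositional.Properties using (shift)
open import Data.List.Relation.Binary.Subset.Propositional using (_⊆_)
open import Data.List.Relation.Binary.Subset.Propositional.Properties
  using (xs⊆x∷xs; ∷⁺ʳ; xs⊆xs++ys; ⊆-reflexive-↭)
open import Data.List.Relation.Unary.All as All using (All; []; _∷_)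
open import Data.List.Relation.Unary.Any using (here; there)
open import Data.Nat using (zero; suc; _+_; _⊔_; _<_; z≤n; s≤s)
open import Data.Nat.Induction using (<-rec)
import Data.Nat.Properties as ℕₚ
import Data.Nat.Tactic.RingSolver as ℕ-Solver
open import Data.Product using (_,_; proj₁; proj₂; ∃; Σ)
open import Data.Product.Properties using (≡-dec)
open import Data.List.Membership.DecPropositional (≡-dec ℤₚ._≟_ ℤₚ._≟_) using (_∈?_)
open import Data.Sum using (inj₁; inj₂)
open import Function using (_∘_)
open import Function.Bundles using (mk⇔)
open import Function.Metric.Nat using (IsMetric)
open import Relation.Binary.Definitions using (tri<; tri≈; tri>)
open import Relation.Binary.PropositionalEquality
  using (_≡_; refl; sym; trans; cong; cong₂; subst; subst₂; isEquivalence; module ≡-Reasoning)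
open import Relation.Nullary using (¬_; yes; no; Dec; _×-dec_; _⊎-dec_)

open CommSemigroupProperties ℕₚ.+-commutativeSemigroup using (xy∙z≈xz∙y; interchange)
open CommSemigroupProperties ℕₚ.⊔-commutativeSemigroup
  using () renaming (xy∙z≈xz∙y to ⊔-swapʳ; xy∙z≈yx∙z to ⊔-swapˡ)

-- Steiner configurations in a metric space

module SteinerShapes {A : Set} {δ : A → A → ℕ} (δ-isMetric : IsMetric _≡_ δ) where

  open IsMetric δ-isMetric public
    using () renaming (sym to δ-sym; triangle to δ-triangle; 0⇒≈ to δ≡0⇒≡)
  open ℕₚ.≤-Reasoning

  private variable
    k l : ℕ
    a b c e v w x y : A

  δ-refl : ∀ x → δ x x ≡ 0
  δ-refl x = IsMetric.≈⇒0 δ-isMetric refl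

  δ-pos : x ≢ y → 0 < δ x y
  δ-pos x≢y = ℕₚ.n≢0⇒n>0 (x≢y ∘ δ≡0⇒≡)

  δ-via : ∀ x s y → δ x y ≤ δ x s + δ y s
  δ-via x s y = ℕₚ.≤-trans (δ-triangle x s y) (ℕₚ.≤-reflexive (cong (δ x s +_) (δ-sym s y)))

  δ-via₂ : ∀ x p q y → δ x y ≤ δ x p + δ p q + δ y q
  δ-via₂ x p q y = begin
    δ x y                   ≤⟨ δ-triangle x p y ⟩
    δ x p + δ p y           ≤⟨ ℕₚ.+-monoʳ-≤ (δ x p) (δ-via p q y) ⟩
    δ x p + (δ p q + δ y q) ≡⟨ ℕₚ.+-assoc (δ x p) (δ p q) (δ y q) ⟨
    δ x p + δ p q + δ y q   ∎

  δ-neighbourˡ : δ v w ≡ 1 → ∀ p → δ w p ≤ suc (δ v p)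
  δ-neighbourˡ {v} {w} vw p = begin
    δ w p         ≤⟨ δ-triangle w v p ⟩
    δ w v + δ v p ≡⟨ cong (_+ δ v p) (trans (δ-sym w v) vw) ⟩
    suc (δ v p)   ∎

  δ-neighbourʳ : δ v w ≡ 1 → ∀ p → δ p w ≤ suc (δ p v)
  δ-neighbourʳ {v} {w} vw p =
    subst₂ (λ m n → m ≤ suc n) (δ-sym w p) (δ-sym v p) (δ-neighbourˡ vw p)

  diam₃ : A → A → A → ℕ
  diam₃ a b c = δ a b ⊔ δ a c ⊔ δ b c

  diam₃-least : δ a b ≤ k → δ a c ≤ k → δ b c ≤ k → diam₃ a b c ≤ k
  diam₃-least ab ac bc = ℕₚ.⊔-lub (ℕₚ.⊔-lub ab ac) bc

  diam₃-swap₁₂ : ∀ a b c → diam₃ a b c ≡ diam₃ b a c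
  diam₃-swap₁₂ a b c =
    trans (cong (λ t → t ⊔ δ a c ⊔ δ b c) (δ-sym a b)) (⊔-swapʳ (δ b a) (δ a c) (δ b c))

  diam₃-swap₂₃ : ∀ a b c → diam₃ a b c ≡ diam₃ a c b
  diam₃-swap₂₃ a b c =
    trans (⊔-swapˡ (δ a b) (δ a c) (δ b c)) (cong (δ a c ⊔ δ a b ⊔_) (δ-sym b c))

  diam₃-rotate : ∀ a b c → diam₃ a b c ≡ diam₃ b c a
  diam₃-rotate a b c = trans (diam₃-swap₁₂ a b c) (diam₃-swap₂₃ b a c)

  diam₃-geodesic : ∀ a b c → δ a c ≡ δ a b + δ b c → diam₃ a b c ≡ δ a c
  diam₃-geodesic a b c ac = ℕₚ.≤-antisym
    (diam₃-least (subst (δ a b ≤_) (sym ac) (ℕₚ.m≤m+n _ _)) ℕₚ.≤-refl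
                 (subst (δ b c ≤_) (sym ac) (ℕₚ.m≤n+m _ _)))
    (ℕₚ.≤-trans (ℕₚ.m≤n⊔m (δ a b) (δ a c)) (ℕₚ.m≤m⊔n _ (δ b c)))

  tripodLength : A → A → A → A → ℕ
  tripodLength a b c s = δ a s + δ b s + δ c s

  record Tripod (k : ℕ) (a b c : A) : Set where
    constructor tripod
    field
      centre  : A
      length≤ : tripodLength a b c centre ≤ k

  Tripod-weaken : k ≤ l → Tripod k a b c → Tripod l a b c
  Tripod-weaken k≤l (tripod s len) = tripod s (ℕₚ.≤-trans len k≤l)

  Tripod-swap₁₂ : Tripod k a b c → Tripod k b a c
  Tripod-swap₁₂ {k} {a} {b} {c} (tripod s len) =
    tripod s (subst (_≤ k) (cong (_+ δ c s) (ℕₚ.+-comm (δ a s) (δ b s))) len)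

  Tripod-swap₂₃ : Tripod k a b c → Tripod k a c b
  Tripod-swap₂₃ {k} {a} {b} {c} (tripod s len) =
    tripod s (subst (_≤ k) (xy∙z≈xz∙y (δ a s) (δ b s) (δ c s)) len)

  Tripod-move₁ : δ v w ≡ 1 → Tripod k v b c → Tripod (suc k) w b c
  Tripod-move₁ {b = b} {c} vw (tripod s len) = tripod s (ℕₚ.≤-trans
    (ℕₚ.+-monoˡ-≤ (δ c s) (ℕₚ.+-monoˡ-≤ (δ b s) (δ-neighbourˡ vw s)))
    (s≤s len))

  Tripod-move₂ : δ v w ≡ 1 → Tripod k a v c → Tripod (suc k) a w c
  Tripod-move₂ vw = Tripod-swap₁₂ ∘ Tripod-move₁ vw ∘ Tripod-swap₁₂

  Tripod-move₃ : δ v w ≡ 1 → Tripod k a b v → Tripod (suc k) a b w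
  Tripod-move₃ vw = Tripod-swap₂₃ ∘ Tripod-move₂ vw ∘ Tripod-swap₂₃

  Tripod-collapse : δ c a ≤ k → Tripod k a a c
  Tripod-collapse {c} {a} {k} ca =
    tripod a (subst (_≤ k) (sym (cong (λ t → t + t + δ c a) (δ-refl a))) ca)

  diam₃≤tripodLength : ∀ a b c s → diam₃ a b c ≤ tripodLength a b c s
  diam₃≤tripodLength a b c s = diam₃-least
    (ℕₚ.≤-trans (δ-via a s b) (ℕₚ.m≤m+n _ (δ c s)))
    (ℕₚ.≤-trans (δ-via a s c) (ℕₚ.+-monoˡ-≤ (δ c s) (ℕₚ.m≤m+n (δ a s) (δ b s))))
    (ℕₚ.≤-trans (δ-via b s c) (ℕₚ.+-monoˡ-≤ (δ c s) (ℕₚ.m≤n+m (δ b s) (δ a s))))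

  hLength : A → A → A → A → A → A → ℕ
  hLength a b c e p q = δ a p + δ b p + δ p q + δ c q + δ e q

  hLength-swapˡ : ∀ a b c e p q → hLength a b c e p q ≡ hLength b a c e p q
  hLength-swapˡ a b c e p q =
    cong (λ t → t + δ p q + δ c q + δ e q) (ℕₚ.+-comm (δ a p) (δ b p))

  hLength-swapʳ : ∀ a b c e p q → hLength a b c e p q ≡ hLength a b e c p q
  hLength-swapʳ a b c e p q = xy∙z≈xz∙y (δ a p + δ b p + δ p q) (δ c q) (δ e q)

  hLength-flip : ∀ a b c e p q → hLength a b c e p q ≡ hLength c e a b q p
  hLength-flip a b c e p q =
    trans (cong (λ t → δ a p + δ b p + t + δ c q + δ e q) (δ-sym p q))
          (rearrange (δ a p) (δ b p) (δ q p) (δ c q) (δ e q))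
    where
    rearrange : ∀ m n o r s → m + n + o + r + s ≡ r + s + o + m + n
    rearrange = ℕ-Solver.solve-∀

  hLength-cross : ∀ a b c e p q → δ a c ≤ hLength a b c e p q
  hLength-cross a b c e p q = begin
    δ a c                                   ≤⟨ δ-via₂ a p q c ⟩
    δ a p + δ p q + δ c q                   ≤⟨ ℕₚ.m≤m+n _ (δ b p + δ e q) ⟩
    δ a p + δ p q + δ c q + (δ b p + δ e q) ≡⟨ rearrange (δ a p) (δ b p) (δ p q) (δ c q) (δ e q) ⟩
    hLength a b c e p q                     ∎
    where
    rearrange : ∀ m n o r s → m + o + r + (n + s) ≡ m + n + o + r + s
    rearrange = ℕ-Solver.solve-∀

  hLength-pairs : ∀ a b c e p q → δ a b + δ c e ≤ hLength a b c e p q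
  hLength-pairs a b c e p q = begin
    δ a b + δ c e                           ≤⟨ ℕₚ.+-mono-≤ (δ-via a p b) (δ-via c q e) ⟩
    δ a p + δ b p + (δ c q + δ e q)         ≤⟨ ℕₚ.m≤m+n _ (δ p q) ⟩
    δ a p + δ b p + (δ c q + δ e q) + δ p q ≡⟨ rearrange (δ a p) (δ b p) (δ p q) (δ c q) (δ e q) ⟩
    hLength a b c e p q                     ∎
    where
    rearrange : ∀ m n o r s → m + n + (r + s) + o ≡ m + n + o + r + s
    rearrange = ℕ-Solver.solve-∀

  diam₃≤hLength : ∀ a z b c p q → diam₃ a b c ≤ hLength a z b c p q
  diam₃≤hLength a z b c p q = diam₃-least
    (hLength-cross a z b c p q)
    (subst (δ a c ≤_) (sym (hLength-swapʳ a z b c p q)) (hLength-cross a z c b p q))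
    (ℕₚ.≤-trans (ℕₚ.m≤n+m (δ b c) (δ a z)) (hLength-pairs a z b c p q))

  record HShape (k : ℕ) (a b c e : A) : Set where
    constructor hshape
    field
      junctionˡ junctionʳ : A
      length≤             : hLength a b c e junctionˡ junctionʳ ≤ k

  HShape-weaken : k ≤ l → HShape k a b c e → HShape l a b c e
  HShape-weaken k≤l (hshape p q len) = hshape p q (ℕₚ.≤-trans len k≤l)

  HShape-swapˡ : HShape k a b c e → HShape k b a c e
  HShape-swapˡ {k} {a} {b} {c} {e} (hshape p q len) =
    hshape p q (subst (_≤ k) (hLength-swapˡ a b c e p q) len)

  HShape-swapʳ : HShape k a b c e → HShape k a b e c
  HShape-swapʳ {k} {a} {b} {c} {e} (hshape p q len) =
    hshape p q (subst (_≤ k) (hLength-swapʳ a b c e p q) len)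

  HShape-flip : HShape k a b c e → HShape k c e a b
  HShape-flip {k} {a} {b} {c} {e} (hshape p q len) =
    hshape q p (subst (_≤ k) (hLength-flip a b c e p q) len)

  HShape-move₁ : δ v w ≡ 1 → HShape k v b c e → HShape (suc k) w b c e
  HShape-move₁ {b = b} {c} {e} vw (hshape p q len) = hshape p q (ℕₚ.≤-trans
    (ℕₚ.+-monoˡ-≤ (δ e q) (ℕₚ.+-monoˡ-≤ (δ c q) (ℕₚ.+-monoˡ-≤ (δ p q)
      (ℕₚ.+-monoˡ-≤ (δ b p) (δ-neighbourˡ vw p)))))
    (s≤s len))

  data HTree (k : ℕ) (a b c e : A) : Set where
    ab∣ce : HShape k a b c e → HTree k a b c e
    ac∣be : HShape k a c b e → HTree k a b c e
    ae∣bc : HShape k a e b c → HTree k a b c e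

  HTree-weaken : k ≤ l → HTree k a b c e → HTree l a b c e
  HTree-weaken k≤l (ab∣ce h) = ab∣ce (HShape-weaken k≤l h)
  HTree-weaken k≤l (ac∣be h) = ac∣be (HShape-weaken k≤l h)
  HTree-weaken k≤l (ae∣bc h) = ae∣bc (HShape-weaken k≤l h)

  HTree-swap₁₂ : HTree k a b c e → HTree k b a c e
  HTree-swap₁₂ (ab∣ce h) = ab∣ce (HShape-swapˡ h)
  HTree-swap₁₂ (ac∣be h) = ae∣bc (HShape-flip h)
  HTree-swap₁₂ (ae∣bc h) = ac∣be (HShape-flip h)

  HTree-swap₂₃ : HTree k a b c e → HTree k a c b e
  HTree-swap₂₃ (ab∣ce h) = ac∣be h
  HTree-swap₂₃ (ac∣be h) = ab∣ce h
  HTree-swap₂₃ (ae∣bc h) = ae∣bc (HShape-swapʳ h)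

  HTree-swap₃₄ : HTree k a b c e → HTree k a b e c
  HTree-swap₃₄ (ab∣ce h) = ab∣ce (HShape-swapʳ h)
  HTree-swap₃₄ (ac∣be h) = ae∣bc h
  HTree-swap₃₄ (ae∣bc h) = ac∣be h

  HTree-move₁ : δ v w ≡ 1 → HTree k v b c e → HTree (suc k) w b c e
  HTree-move₁ vw (ab∣ce h) = ab∣ce (HShape-move₁ vw h)
  HTree-move₁ vw (ac∣be h) = ac∣be (HShape-move₁ vw h)
  HTree-move₁ vw (ae∣bc h) = ae∣bc (HShape-move₁ vw h)

  HTree-move₂ : δ v w ≡ 1 → HTree k a v c e → HTree (suc k) a w c e
  HTree-move₂ vw = HTree-swap₁₂ ∘ HTree-move₁ vw ∘ HTree-swap₁₂

  HTree-move₃ : δ v w ≡ 1 → HTree k a b v e → HTree (suc k) a b w e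
  HTree-move₃ vw = HTree-swap₂₃ ∘ HTree-move₂ vw ∘ HTree-swap₂₃

  HTree-move₄ : δ v w ≡ 1 → HTree k a b c v → HTree (suc k) a b c w
  HTree-move₄ vw = HTree-swap₃₄ ∘ HTree-move₃ vw ∘ HTree-swap₃₄

  HTree-collapse : Tripod k a c e → HTree k a a c e
  HTree-collapse {k} {a} {c} {e} (tripod s len) = ab∣ce (hshape a s
    (subst (_≤ k) (sym (cong (λ t → t + t + δ a s + δ c s + δ e s) (δ-refl a))) len))

-- Distances on ℤ

dist : ℤ → ℤ → ℕ
dist x y = ∣ x - y ∣

dist-triangle : ∀ x y z → dist x z ≤ dist x y + dist y z
dist-triangle x y z = subst (λ t → ∣ t ∣ ≤ dist x y + dist y z) (telescope x y z)
                            (ℤₚ.∣i+j∣≤∣i∣+∣j∣ (x - y) (y - z))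
  where
  telescope : ∀ x y z → (x - y) ℤ.+ (y - z) ≡ x - z
  telescope = ℤ-Solver.solve-∀

dist-isMetric : IsMetric _≡_ dist
dist-isMetric = record
  { isSemiMetric = record
    { isQuasiSemiMetric = record
      { isPreMetric = record
        { isProtoMetric = record
          { isPartialOrder  = ℕₚ.≤-isPartialOrder
          ; ≈-isEquivalence = isEquivalence
          ; cong            = cong₂ dist
          ; nonNegative     = z≤n
          }
        ; ≈⇒0 = λ { {x} refl → cong ∣_∣ (ℤₚ.+-inverseʳ x) }
        }
      ; 0⇒≈ = λ {x} {y} → ℤₚ.i-j≡0⇒i≡j x y ∘ ℤₚ.∣i∣≡0⇒i≡0
      }
    ; sym = ℤₚ.∣i-j∣≡∣j-i∣
    }
  ; triangle = dist-triangle
  }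

module Line = SteinerShapes dist-isMetric

dist-additive : ∀ {x y z} → x ℤ.≤ y → y ℤ.≤ z → dist x z ≡ dist x y + dist y z
dist-additive {x} {y} {z} x≤y y≤z = ℤₚ.+-injective (begin
  ℤ.+ dist x z                  ≡⟨ ℤₚ.∣-∣-≤ (ℤₚ.≤-trans x≤y y≤z) ⟩
  z - x                         ≡⟨ telescope x y z ⟩
  (y - x) ℤ.+ (z - y)           ≡⟨ cong₂ ℤ._+_ (ℤₚ.∣-∣-≤ x≤y) (ℤₚ.∣-∣-≤ y≤z) ⟨
  ℤ.+ dist x y ℤ.+ ℤ.+ dist y z ≡⟨ ℤₚ.pos-+ (dist x y) (dist y z) ⟨
  ℤ.+ (dist x y + dist y z)     ∎)
  where
  open ≡-Reasoning
  telescope : ∀ x y z → z - x ≡ (y - x) ℤ.+ (z - y)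
  telescope = ℤ-Solver.solve-∀

dist-additive⁻ : ∀ {x y z} → x ℤ.≤ y → y ℤ.≤ z → dist z x ≡ dist z y + dist y x
dist-additive⁻ {x} {y} {z} x≤y y≤z = begin
  dist z x            ≡⟨ Line.δ-sym z x ⟩
  dist x z            ≡⟨ dist-additive x≤y y≤z ⟩
  dist x y + dist y z ≡⟨ ℕₚ.+-comm (dist x y) (dist y z) ⟩
  dist y z + dist x y ≡⟨ cong₂ _+_ (Line.δ-sym y z) (Line.δ-sym x y) ⟩
  dist z y + dist y x ∎
  where open ≡-Reasoning

dist-extendʳ : ∀ {x y z} → x ℤ.≤ y → y ℤ.< z → dist x y < dist x z
dist-extendʳ {x} {y} {z} x≤y y<z = subst (dist x y <_) (sym (dist-additive x≤y (ℤₚ.<⇒≤ y<z)))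
  (ℕₚ.m<m+n (dist x y) (Line.δ-pos (ℤₚ.<⇒≢ y<z)))

dist-extendˡ : ∀ {x y z} → x ℤ.< y → y ℤ.≤ z → dist y z < dist x z
dist-extendˡ {x} {y} {z} x<y y≤z = subst (dist y z <_) (sym (dist-additive (ℤₚ.<⇒≤ x<y) y≤z))
  (ℕₚ.m<n+m (dist y z) (Line.δ-pos (ℤₚ.<⇒≢ x<y)))

diam₃-sorted : ∀ {x y z} → x ℤ.≤ y → y ℤ.≤ z → Line.diam₃ x y z ≡ dist x z
diam₃-sorted {x} {y} {z} x≤y y≤z = Line.diam₃-geodesic x y z (dist-additive x≤y y≤z)

dist-unit : ∀ x → dist x (ℤ.suc x) ≡ 1
dist-unit x = cong ∣_∣ (difference x)
  where
  difference : ∀ x → x - (ℤ.+ 1 ℤ.+ x) ≡ ℤ.- ℤ.+ 1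
  difference = ℤ-Solver.solve-∀

dist-step : ∀ x t {n} → dist x t ≡ suc n → ∃ λ u → dist x u ≡ 1 × dist u t ≡ n
dist-step x t xt with ℤₚ.<-cmp x t
... | tri< x<t _ _ = ℤ.suc x , dist-unit x , ℕₚ.suc-injective (trans (sym split) xt)
  where
  split : dist x t ≡ suc (dist (ℤ.suc x) t)
  split = trans (dist-additive (ℤₚ.i≤suc[i] x) (ℤₚ.i<j⇒suc[i]≤j x<t))
                (cong (_+ dist (ℤ.suc x) t) (dist-unit x))
... | tri≈ _ refl _ = ⊥-elim (ℕₚ.0≢1+n (trans (sym (Line.δ-refl x)) xt))
... | tri> _ _ t<x = ℤ.pred x , unit , ℕₚ.suc-injective (trans (sym split) xt)
  where
  unit : dist x (ℤ.pred x) ≡ 1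
  unit = trans (Line.δ-sym x (ℤ.pred x))
               (subst (λ y → dist (ℤ.pred x) y ≡ 1) (ℤₚ.suc-pred x) (dist-unit (ℤ.pred x)))
  split : dist x t ≡ suc (dist (ℤ.pred x) t)
  split = trans (dist-additive⁻ (ℤₚ.i<j⇒i≤pred[j] t<x) (ℤₚ.i≤j⇒pred[i]≤j (ℤₚ.≤-refl {x})))
                (cong (_+ dist (ℤ.pred x) t) unit)

Between : ℤ → ℤ → ℤ → Set
Between a b z = a ℤ.⊓ b ℤ.≤ z × z ℤ.≤ a ℤ.⊔ b

Between? : ∀ a b z → Dec (Between a b z)
Between? a b z = (a ℤ.⊓ b ℤₚ.≤? z) ×-dec (z ℤₚ.≤? a ℤ.⊔ b)

Between-sym : ∀ {a b z} → Between a b z → Between b a z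
Between-sym {a} {b} (lo , hi) =
  subst (ℤ._≤ _) (ℤₚ.⊓-comm a b) lo , subst (_ ℤ.≤_) (ℤₚ.⊔-comm a b) hi

Between-left : ∀ a b → Between a b a
Between-left a b = ℤₚ.i⊓j≤i a b , ℤₚ.i≤i⊔j a b

≤-Between : ∀ {a b z} → a ℤ.≤ z → z ℤ.≤ b → Between a b z
≤-Between {a} {b} a≤z z≤b = ℤₚ.i≤j⇒i⊓k≤j b a≤z , ℤₚ.i≤j⇒i≤k⊔j a z≤b

Between-≤ : ∀ {a b z} → a ℤ.≤ b → Between a b z → a ℤ.≤ z × z ℤ.≤ b
Between-≤ a≤b (lo , hi) =
  subst (ℤ._≤ _) (ℤₚ.i≤j⇒i⊓j≡i a≤b) lo , subst (_ ℤ.≤_) (ℤₚ.i≤j⇒i⊔j≡j a≤b) hi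

outside-a≤b≤c : ∀ {n a b c z} → a ℤ.≤ b → b ℤ.≤ c → ¬ (Between a b z × Between a c z) →
  dist z c ≤ n → dist a z + dist b c ≤ n → dist a c < n
outside-a≤b≤c {n} {a} {b} {c} {z} a≤b b≤c outside zc azbc with z ℤₚ.<? a | b ℤₚ.<? z
... | yes z<a | _ = ℕₚ.<-≤-trans (dist-extendˡ z<a (ℤₚ.≤-trans a≤b b≤c)) zc
... | no _ | yes b<z = begin-strict
  dist a c            ≡⟨ dist-additive a≤b b≤c ⟩
  dist a b + dist b c <⟨ ℕₚ.+-monoˡ-< (dist b c) (dist-extendʳ a≤b b<z) ⟩
  dist a z + dist b c ≤⟨ azbc ⟩
  n                   ∎
  where open ℕₚ.≤-Reasoning
... | no z≮a | no b≮z = ⊥-elim (outside (≤-Between a≤z z≤b , ≤-Between a≤z (ℤₚ.≤-trans z≤b b≤c)))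
  where
  a≤z = ℤₚ.≮⇒≥ z≮a
  z≤b = ℤₚ.≮⇒≥ b≮z

outside-z≢a : ∀ {n a b c z} → ¬ (Between a b z × Between a c z) →
  dist a z + dist b c ≤ n → dist b c < n
outside-z≢a {n} {a} {b} {c} {z} outside azbc with a ℤₚ.≟ z
... | yes refl = ⊥-elim (outside (Between-left a b , Between-left a c))
... | no a≢z = ℕₚ.<-≤-trans (ℕₚ.m<n+m (dist b c) (Line.δ-pos a≢z)) azbc

outside-b≤c≤a : ∀ {n a b c z} → b ℤ.≤ c → c ℤ.≤ a → ¬ (Between a b z × Between a c z) →
  dist z b ≤ n → dist a z + dist b c ≤ n → dist b a < n
outside-b≤c≤a {n} {a} {b} {c} {z} b≤c c≤a outside zb azbc with a ℤₚ.<? z | z ℤₚ.<? c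
... | yes a<z | _ = ℕₚ.<-≤-trans (dist-extendʳ (ℤₚ.≤-trans b≤c c≤a) a<z) (subst (_≤ n) (Line.δ-sym z b) zb)
... | no _ | yes z<c = begin-strict
  dist b a            ≡⟨ dist-additive b≤c c≤a ⟩
  dist b c + dist c a <⟨ ℕₚ.+-monoʳ-< (dist b c) (dist-extendˡ z<c c≤a) ⟩
  dist b c + dist z a ≡⟨ ℕₚ.+-comm (dist b c) (dist z a) ⟩
  dist z a + dist b c ≡⟨ cong (_+ dist b c) (Line.δ-sym z a) ⟩
  dist a z + dist b c ≤⟨ azbc ⟩
  n                   ∎
  where open ℕₚ.≤-Reasoning
... | no a≮z | no z≮c =
  ⊥-elim (outside (Between-sym (≤-Between (ℤₚ.≤-trans b≤c c≤z) z≤a) , Between-sym (≤-Between c≤z z≤a)))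
  where
  z≤a = ℤₚ.≮⇒≥ a≮z
  c≤z = ℤₚ.≮⇒≥ z≮c

diam₃<-outside-≤ : ∀ {n a b c z} → b ℤ.≤ c → ¬ (Between a b z × Between a c z) →
  dist z b ≤ n → dist z c ≤ n → dist a z + dist b c ≤ n → Line.diam₃ a b c < n
diam₃<-outside-≤ {n} {a} {b} {c} b≤c outside zb zc azbc with ℤₚ.≤-total a b | ℤₚ.≤-total a c
... | inj₁ a≤b | _ =
  subst (_< n) (sym (diam₃-sorted a≤b b≤c)) (outside-a≤b≤c a≤b b≤c outside zc azbc)
... | inj₂ b≤a | inj₁ a≤c =
  subst (_< n) (sym (trans (Line.diam₃-swap₁₂ a b c) (diam₃-sorted b≤a a≤c)))
        (outside-z≢a outside azbc)
... | inj₂ b≤a | inj₂ c≤a =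
  subst (_< n) (sym (trans (Line.diam₃-rotate a b c) (diam₃-sorted b≤c c≤a)))
        (outside-b≤c≤a b≤c c≤a outside zb azbc)

diam₃<-outside : ∀ {n a b c z} → ¬ (Between a b z × Between a c z) →
  dist z b ≤ n → dist z c ≤ n → dist a z + dist b c ≤ n → Line.diam₃ a b c < n
diam₃<-outside {n} {a} {b} {c} {z} outside zb zc azbc with ℤₚ.≤-total b c
... | inj₁ b≤c = diam₃<-outside-≤ b≤c outside zb zc azbc
... | inj₂ c≤b = subst (_< n) (Line.diam₃-swap₂₃ a c b)
  (diam₃<-outside-≤ c≤b (λ (zc , zb) → outside (zb , zc)) zc zb
    (subst (λ t → dist a z + t ≤ n) (Line.δ-sym b c) azbc))

median-path-≤ : ∀ {a b c z} → b ℤ.≤ c → Between a b z → Between a c z →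
  ∃ λ m → dist a z + dist z m + dist m b + dist m c ≡ Line.diam₃ a b c
median-path-≤ {a} {b} {c} {z} b≤c zab zac with ℤₚ.≤-total a b | ℤₚ.≤-total a c
... | inj₁ a≤b | _ = b , (begin
  dist a z + dist z b + dist b b + dist b c ≡⟨ cong (λ t → dist a z + dist z b + t + dist b c)
                                                     (Line.δ-refl b) ⟩
  dist a z + dist z b + 0 + dist b c        ≡⟨ cong (_+ dist b c) (ℕₚ.+-identityʳ _) ⟩
  dist a z + dist z b + dist b c            ≡⟨ cong (_+ dist b c) (dist-additive a≤z z≤b) ⟨
  dist a b + dist b c                       ≡⟨ dist-additive a≤b b≤c ⟨
  dist a c                                  ≡⟨ diam₃-sorted a≤b b≤c ⟨
  Line.diam₃ a b c                          ∎)
  where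
  open ≡-Reasoning
  a≤z = proj₁ (Between-≤ a≤b zab)
  z≤b = proj₂ (Between-≤ a≤b zab)
... | inj₂ b≤a | inj₁ a≤c
  with ℤₚ.≤-antisym (proj₂ (Between-≤ b≤a (Between-sym zab))) (proj₁ (Between-≤ a≤c zac))
...   | refl = a , (begin
  dist a a + dist a a + dist a b + dist a c ≡⟨ cong (λ t → t + t + dist a b + dist a c) (Line.δ-refl a) ⟩
  dist a b + dist a c                       ≡⟨ cong (_+ dist a c) (Line.δ-sym a b) ⟩
  dist b a + dist a c                       ≡⟨ dist-additive b≤a a≤c ⟨
  dist b c                                  ≡⟨ trans (Line.diam₃-swap₁₂ a b c) (diam₃-sorted b≤a a≤c) ⟨
  Line.diam₃ a b c                          ∎)
  where open ≡-Reasoning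
median-path-≤ {a} {b} {c} {z} b≤c zab zac | inj₂ b≤a | inj₂ c≤a = c , (begin
  dist a z + dist z c + dist c b + dist c c ≡⟨ cong (dist a z + dist z c + dist c b +_) (Line.δ-refl c) ⟩
  dist a z + dist z c + dist c b + 0        ≡⟨ ℕₚ.+-identityʳ _ ⟩
  dist a z + dist z c + dist c b            ≡⟨ cong (_+ dist c b) (dist-additive⁻ c≤z z≤a) ⟨
  dist a c + dist c b                       ≡⟨ dist-additive⁻ b≤c c≤a ⟨
  dist a b                                  ≡⟨ Line.δ-sym a b ⟩
  dist b a                                  ≡⟨ trans (Line.diam₃-rotate a b c) (diam₃-sorted b≤c c≤a) ⟨
  Line.diam₃ a b c                          ∎)
  where
  open ≡-Reasoning
  c≤z = proj₁ (Between-≤ c≤a (Between-sym zac))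
  z≤a = proj₂ (Between-≤ c≤a (Between-sym zac))

median-path : ∀ {a b c z} → Between a b z → Between a c z →
  ∃ λ m → dist a z + dist z m + dist m b + dist m c ≡ Line.diam₃ a b c
median-path {a} {b} {c} {z} zab zac with ℤₚ.≤-total b c
... | inj₁ b≤c = median-path-≤ b≤c zab zac
... | inj₂ c≤b with median-path-≤ c≤b zac zab
...   | m , len = m , trans (xy∙z≈xz∙y (dist a z + dist z m) (dist m b) (dist m c))
                          (trans len (sym (Line.diam₃-swap₂₃ a b c)))

-- The taxicab plane

-- Defined by matching on pairs, like Adj, so that Adj v w is definitionally taxicab v w ≡ 1.
taxicab : Point → Point → ℕ
taxicab (x₁ , y₁) (x₂ , y₂) = dist x₁ x₂ + dist y₁ y₂

taxicab-isMetric : IsMetric _≡_ taxicab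
taxicab-isMetric = record
  { isSemiMetric = record
    { isQuasiSemiMetric = record
      { isPreMetric = record
        { isProtoMetric = record
          { isPartialOrder  = ℕₚ.≤-isPartialOrder
          ; ≈-isEquivalence = isEquivalence
          ; cong            = cong₂ taxicab
          ; nonNegative     = z≤n
          }
        ; ≈⇒0 = λ { {x , y} refl → cong₂ _+_ (Line.δ-refl x) (Line.δ-refl y) }
        }
      ; 0⇒≈ = λ { {x₁ , y₁} {x₂ , y₂} h → cong₂ _,_ (Line.δ≡0⇒≡ (ℕₚ.m+n≡0⇒m≡0 _ h))
                                                   (Line.δ≡0⇒≡ (ℕₚ.m+n≡0⇒n≡0 (dist x₁ x₂) h)) }
      }
    ; sym = λ { (x₁ , y₁) (x₂ , y₂) → cong₂ _+_ (Line.δ-sym x₁ x₂) (Line.δ-sym y₁ y₂) }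
    }
  ; triangle = λ { (x₁ , y₁) (x₂ , y₂) (x₃ , y₃) → ℕₚ.≤-trans
      (ℕₚ.+-mono-≤ (dist-triangle x₁ x₂ x₃) (dist-triangle y₁ y₂ y₃))
      (ℕₚ.≤-reflexive (interchange (dist x₁ x₂) (dist x₂ x₃) (dist y₁ y₂) (dist y₂ y₃))) }
  }

open SteinerShapes taxicab-isMetric

taxicab-step : ∀ v t {n} → taxicab v t ≡ suc n → ∃ λ u → taxicab v u ≡ 1 × taxicab u t ≡ n
taxicab-step (x₁ , y₁) (x₂ , y₂) vt with dist x₁ x₂ in xx
... | zero with dist-step y₁ y₂ vt
...   | y , yy , yt =
  (x₁ , y) , trans (cong (_+ dist y₁ y) (Line.δ-refl x₁)) yy , trans (cong (_+ dist y y₂) xx) yt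
taxicab-step (x₁ , y₁) (x₂ , y₂) vt | suc m with dist-step x₁ x₂ xx
...   | x , xx′ , xt =
  (x , y₁) , trans (cong (dist x₁ x +_) (Line.δ-refl y₁)) (trans (ℕₚ.+-identityʳ _) xx′) ,
  trans (cong (_+ dist y₁ y₂) xt) (ℕₚ.suc-injective vt)

halfPerimeter : Point → Point → Point → ℕ
halfPerimeter (a₁ , a₂) (b₁ , b₂) (c₁ , c₂) = Line.diam₃ a₁ b₁ c₁ + Line.diam₃ a₂ b₂ c₂

halfPerimeter-swap₁₂ : ∀ a b c → halfPerimeter a b c ≡ halfPerimeter b a c
halfPerimeter-swap₁₂ (a₁ , a₂) (b₁ , b₂) (c₁ , c₂) =
  cong₂ _+_ (Line.diam₃-swap₁₂ a₁ b₁ c₁) (Line.diam₃-swap₁₂ a₂ b₂ c₂)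

halfPerimeter-rotate : ∀ a b c → halfPerimeter a b c ≡ halfPerimeter b c a
halfPerimeter-rotate (a₁ , a₂) (b₁ , b₂) (c₁ , c₂) =
  cong₂ _+_ (Line.diam₃-rotate a₁ b₁ c₁) (Line.diam₃-rotate a₂ b₂ c₂)

InRect-sym : ∀ {u w z} → InRect u w z → InRect w u z
InRect-sym (z₁ , z₂) = Between-sym z₁ , Between-sym z₂

InRect-left : ∀ u w → InRect u w u
InRect-left (u₁ , u₂) (w₁ , w₂) = Between-left u₁ w₁ , Between-left u₂ w₂

InRect? : ∀ u w z → Dec (InRect u w z)
InRect? (u₁ , u₂) (w₁ , w₂) (z₁ , z₂) = Between? u₁ w₁ z₁ ×-dec Between? u₂ w₂ z₂

Tripod⇒halfPerimeter≤ : ∀ {k a b c} → Tripod k a b c → halfPerimeter a b c ≤ k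
Tripod⇒halfPerimeter≤ {k} {a₁ , a₂} {b₁ , b₂} {c₁ , c₂} (tripod (s₁ , s₂) len) = begin
  Line.diam₃ a₁ b₁ c₁ + Line.diam₃ a₂ b₂ c₂
    ≤⟨ ℕₚ.+-mono-≤ (Line.diam₃≤tripodLength a₁ b₁ c₁ s₁) (Line.diam₃≤tripodLength a₂ b₂ c₂ s₂) ⟩
  Line.tripodLength a₁ b₁ c₁ s₁ + Line.tripodLength a₂ b₂ c₂ s₂
    ≡⟨ regroup (dist a₁ s₁) (dist a₂ s₂) (dist b₁ s₁) (dist b₂ s₂) (dist c₁ s₁) (dist c₂ s₂) ⟨
  tripodLength (a₁ , a₂) (b₁ , b₂) (c₁ , c₂) (s₁ , s₂)
    ≤⟨ len ⟩
  k ∎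
  where
  open ℕₚ.≤-Reasoning
  regroup : ∀ a₁ a₂ b₁ b₂ c₁ c₂ →
    a₁ + a₂ + (b₁ + b₂) + (c₁ + c₂) ≡ a₁ + b₁ + c₁ + (a₂ + b₂ + c₂)
  regroup = ℕ-Solver.solve-∀

diam₃<hLength : ∀ {a z b c} p q → ¬ (Between a b z × Between a c z) →
  Line.diam₃ a b c < Line.hLength a z b c p q
diam₃<hLength {a} {z} {b} {c} p q outside =
  diam₃<-outside outside zb zc (Line.hLength-pairs a z b c p q)
  where
  zb : dist z b ≤ Line.hLength a z b c p q
  zb = subst (dist z b ≤_) (sym (Line.hLength-swapˡ a z b c p q)) (Line.hLength-cross z a b c p q)
  zc : dist z c ≤ Line.hLength a z b c p q
  zc = subst (dist z c ≤_)
             (sym (trans (Line.hLength-swapˡ a z b c p q) (Line.hLength-swapʳ z a b c p q)))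
             (Line.hLength-cross z a c b p q)

HShape-outside : ∀ {k a b c z} → ¬ (InRect a b z × InRect a c z) → HShape k a z b c →
  halfPerimeter a b c < k
HShape-outside {k} {a₁ , a₂} {b₁ , b₂} {c₁ , c₂} {z₁ , z₂} outside (hshape (p₁ , p₂) (q₁ , q₂) len) =
  begin-strict
  Line.diam₃ a₁ b₁ c₁ + Line.diam₃ a₂ b₂ c₂
    <⟨ coordinatewise ⟩
  Line.hLength a₁ z₁ b₁ c₁ p₁ q₁ + Line.hLength a₂ z₂ b₂ c₂ p₂ q₂
    ≡⟨ regroup (dist a₁ p₁) (dist a₂ p₂) (dist z₁ p₁) (dist z₂ p₂) (dist p₁ q₁) (dist p₂ q₂)
               (dist b₁ q₁) (dist b₂ q₂) (dist c₁ q₁) (dist c₂ q₂) ⟨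
  hLength (a₁ , a₂) (z₁ , z₂) (b₁ , b₂) (c₁ , c₂) (p₁ , p₂) (q₁ , q₂)
    ≤⟨ len ⟩
  k ∎
  where
  open ℕₚ.≤-Reasoning
  regroup : ∀ a₁ a₂ z₁ z₂ m₁ m₂ b₁ b₂ c₁ c₂ →
    a₁ + a₂ + (z₁ + z₂) + (m₁ + m₂) + (b₁ + b₂) + (c₁ + c₂) ≡
    a₁ + z₁ + m₁ + b₁ + c₁ + (a₂ + z₂ + m₂ + b₂ + c₂)
  regroup = ℕ-Solver.solve-∀
  coordinatewise : Line.diam₃ a₁ b₁ c₁ + Line.diam₃ a₂ b₂ c₂ <
                   Line.hLength a₁ z₁ b₁ c₁ p₁ q₁ + Line.hLength a₂ z₂ b₂ c₂ p₂ q₂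
  coordinatewise with Between? a₁ b₁ z₁ ×-dec Between? a₁ c₁ z₁
  ... | yes (zb₁ , zc₁) = ℕₚ.+-mono-≤-< (Line.diam₃≤hLength a₁ z₁ b₁ c₁ p₁ q₁)
    (diam₃<hLength p₂ q₂ λ (zb₂ , zc₂) → outside ((zb₁ , zb₂) , (zc₁ , zc₂)))
  ... | no outside₁ = ℕₚ.+-mono-<-≤ (diam₃<hLength p₁ q₁ outside₁)
                                    (Line.diam₃≤hLength a₂ z₂ b₂ c₂ p₂ q₂)

-- Grid trees

GridTree-dist : ∀ {V k a b} → GridTree V k → a ∈ V → b ∈ V → taxicab a b ≤ k
GridTree-dist (single p) (here refl) (here refl) = ℕₚ.≤-reflexive (δ-refl p)
GridTree-dist {a = a} (grow _ _ _ _) (here refl) (here refl) =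
  ℕₚ.≤-trans (ℕₚ.≤-reflexive (δ-refl a)) z≤n
GridTree-dist {b = b} (grow T {v} {w} v∈V vw _) (here refl) (there b∈V) =
  ℕₚ.≤-trans (δ-neighbourˡ {v} {w} vw b) (s≤s (GridTree-dist T v∈V b∈V))
GridTree-dist {a = a} (grow T {v} {w} v∈V vw _) (there a∈V) (here refl) =
  ℕₚ.≤-trans (δ-neighbourʳ {v} {w} vw a) (s≤s (GridTree-dist T a∈V v∈V))
GridTree-dist (grow T _ _ _) (there a∈V) (there b∈V) = ℕₚ.m≤n⇒m≤1+n (GridTree-dist T a∈V b∈V)

GridTree-tripod : ∀ {V k a b c} → GridTree V k → a ∈ V → b ∈ V → c ∈ V → Tripod k a b c
GridTree-tripod (single p) (here refl) (here refl) (here refl) =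
  tripod p (ℕₚ.≤-reflexive (cong (λ t → t + t + t) (δ-refl p)))
GridTree-tripod T@(grow _ _ _ _) (here refl) (here refl) c∈V =
  Tripod-collapse (GridTree-dist T c∈V (here refl))
GridTree-tripod T@(grow _ _ _ _) (here refl) b∈V (here refl) =
  Tripod-swap₂₃ (Tripod-collapse (GridTree-dist T b∈V (here refl)))
GridTree-tripod T@(grow _ _ _ _) a∈V (here refl) (here refl) =
  Tripod-swap₁₂ (Tripod-swap₂₃ (Tripod-collapse (GridTree-dist T a∈V (here refl))))
GridTree-tripod (grow T v∈V vw _) (here refl) (there b∈V) (there c∈V) =
  Tripod-move₁ vw (GridTree-tripod T v∈V b∈V c∈V)
GridTree-tripod (grow T v∈V vw _) (there a∈V) (here refl) (there c∈V) =
  Tripod-move₂ vw (GridTree-tripod T a∈V v∈V c∈V)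
GridTree-tripod (grow T v∈V vw _) (there a∈V) (there b∈V) (here refl) =
  Tripod-move₃ vw (GridTree-tripod T a∈V b∈V v∈V)
GridTree-tripod (grow T _ _ _) (there a∈V) (there b∈V) (there c∈V) =
  Tripod-weaken (ℕₚ.n≤1+n _) (GridTree-tripod T a∈V b∈V c∈V)

GridTree-HTree : ∀ {V k a b c e} → GridTree V k →
  a ∈ V → b ∈ V → c ∈ V → e ∈ V → HTree k a b c e
GridTree-HTree (single p) (here refl) (here refl) (here refl) (here refl) =
  ab∣ce (hshape p p (ℕₚ.≤-reflexive (cong (λ t → t + t + t + t + t) (δ-refl p))))
GridTree-HTree T@(grow _ _ _ _) (here refl) (here refl) c∈V e∈V =
  HTree-collapse (GridTree-tripod T (here refl) c∈V e∈V)
GridTree-HTree T@(grow _ _ _ _) (here refl) b∈V (here refl) e∈V =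
  HTree-swap₂₃ (HTree-collapse (GridTree-tripod T (here refl) b∈V e∈V))
GridTree-HTree T@(grow _ _ _ _) (here refl) b∈V c∈V (here refl) =
  HTree-swap₃₄ (HTree-swap₂₃ (HTree-collapse (GridTree-tripod T (here refl) b∈V c∈V)))
GridTree-HTree T@(grow _ _ _ _) a∈V (here refl) (here refl) e∈V =
  HTree-swap₁₂ (HTree-swap₂₃ (HTree-collapse (GridTree-tripod T (here refl) a∈V e∈V)))
GridTree-HTree T@(grow _ _ _ _) a∈V (here refl) c∈V (here refl) =
  HTree-swap₁₂ (HTree-swap₃₄ (HTree-swap₂₃
    (HTree-collapse (GridTree-tripod T (here refl) a∈V c∈V))))
GridTree-HTree T@(grow _ _ _ _) a∈V b∈V (here refl) (here refl) =
  HTree-swap₂₃ (HTree-swap₃₄ (HTree-swap₁₂ (HTree-swap₂₃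
    (HTree-collapse (GridTree-tripod T (here refl) a∈V b∈V)))))
GridTree-HTree (grow T v∈V vw _) (here refl) (there b∈V) (there c∈V) (there e∈V) =
  HTree-move₁ vw (GridTree-HTree T v∈V b∈V c∈V e∈V)
GridTree-HTree (grow T v∈V vw _) (there a∈V) (here refl) (there c∈V) (there e∈V) =
  HTree-move₂ vw (GridTree-HTree T a∈V v∈V c∈V e∈V)
GridTree-HTree (grow T v∈V vw _) (there a∈V) (there b∈V) (here refl) (there e∈V) =
  HTree-move₃ vw (GridTree-HTree T a∈V b∈V v∈V e∈V)
GridTree-HTree (grow T v∈V vw _) (there a∈V) (there b∈V) (there c∈V) (here refl) =
  HTree-move₄ vw (GridTree-HTree T a∈V b∈V c∈V v∈V)
GridTree-HTree (grow T _ _ _) (there a∈V) (there b∈V) (there c∈V) (there e∈V) =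
  HTree-weaken (ℕₚ.n≤1+n _) (GridTree-HTree T a∈V b∈V c∈V e∈V)

record Connects (S : List Point) (n : ℕ) : Set where
  constructor connects
  field
    {vertices} : List Point
    {edges}    : ℕ
    tree       : GridTree vertices edges
    edges≤     : edges ≤ n
    spans      : All (_∈ vertices) S

Connects-mono : ∀ {S S′ m n} → S′ ⊆ S → m ≤ n → Connects S m → Connects S′ n
Connects-mono S′⊆S m≤n (connects T k≤m spans) =
  connects T (ℕₚ.≤-trans k≤m m≤n) (All.tabulate (All.lookup spans ∘ S′⊆S))

Connects-path : ∀ {S n v t} m → Connects S n → v ∈ S → taxicab v t ≡ m →
  Connects (t ∷ S) (n + m)
Connects-path {S} {n} zero C v∈S vt = Connects-mono
  (λ { (here refl) → subst (_∈ S) (δ≡0⇒≡ vt) v∈S ; (there t∈S) → t∈S }) (ℕₚ.m≤m+n n 0) C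
Connects-path {S} {n} {v} {t} (suc m) (connects {V} T k≤n spans) v∈S vt
  with taxicab-step v t vt
... | u , vu , ut with u ∈? V
...   | yes u∈V = Connects-mono (∷⁺ʳ t (xs⊆x∷xs S u)) (ℕₚ.+-monoʳ-≤ n (ℕₚ.n≤1+n m))
                   (Connects-path m (connects T k≤n (u∈V ∷ spans)) (here refl) ut)
...   | no u∉V  = Connects-mono (∷⁺ʳ t (xs⊆x∷xs S u)) (ℕₚ.≤-reflexive (sym (ℕₚ.+-suc n m)))
                   (Connects-path m (connects (grow T (All.lookup spans v∈S) vu u∉V) (s≤s k≤n)
                                              (here refl ∷ All.map there spans))
                                    (here refl) ut)

Connects-extend : ∀ {S n v} → Connects S n → v ∈ S → ∀ t → Connects (t ∷ S) (n + taxicab v t)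
Connects-extend {v = v} C v∈S t = Connects-path (taxicab v t) C v∈S refl

Connects-rect : ∀ {a b c z} → InRect a b z → InRect a c z →
  Connects (a ∷ b ∷ c ∷ z ∷ []) (halfPerimeter a b c)
Connects-rect {a₁ , a₂} {b₁ , b₂} {c₁ , c₂} {z₁ , z₂} (zb₁ , zb₂) (zc₁ , zc₂)
  with median-path zb₁ zc₁ | median-path zb₂ zc₂
... | m₁ , path₁ | m₂ , path₂ = Connects-mono reorder (ℕₚ.≤-reflexive length) tree
  where
  a = a₁ , a₂
  b = b₁ , b₂
  c = c₁ , c₂
  z = z₁ , z₂
  m = m₁ , m₂
  tree : Connects (c ∷ b ∷ m ∷ z ∷ a ∷ []) (taxicab a z + taxicab z m + taxicab m b + taxicab m c)
  tree = Connects-extend (Connects-extend (Connects-extend (Connects-extend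
           (connects (single a) ℕₚ.≤-refl (here refl ∷ [])) (here refl) z) (here refl) m) (here refl) b)
           (there (here refl)) c
  reorder : (a ∷ b ∷ c ∷ z ∷ []) ⊆ (c ∷ b ∷ m ∷ z ∷ a ∷ [])
  reorder (here refl)                         = there (there (there (there (here refl))))
  reorder (there (here refl))                 = there (here refl)
  reorder (there (there (here refl)))         = here refl
  reorder (there (there (there (here refl)))) = there (there (there (here refl)))
  regroup : ∀ a₁ a₂ z₁ z₂ b₁ b₂ c₁ c₂ →
    a₁ + a₂ + (z₁ + z₂) + (b₁ + b₂) + (c₁ + c₂) ≡ a₁ + z₁ + b₁ + c₁ + (a₂ + z₂ + b₂ + c₂)
  regroup = ℕ-Solver.solve-∀
  length : taxicab a z + taxicab z m + taxicab m b + taxicab m c ≡ halfPerimeter a b c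
  length = trans (regroup (dist a₁ z₁) (dist a₂ z₂) (dist z₁ m₁) (dist z₂ m₂)
                          (dist m₁ b₁) (dist m₂ b₂) (dist m₁ c₁) (dist m₂ c₂))
                 (cong₂ _+_ path₁ path₂)

-- Steiner distances

IsSteinerDist-≤ : ∀ {S d n} → IsSteinerDist S d → Connects S n → d ≤ n
IsSteinerDist-≤ (_ , minimal) (connects T k≤n spans) = ℕₚ.≤-trans (minimal _ _ T spans) k≤n

IsSteinerDist⇒Connects : ∀ {S d} → IsSteinerDist S d → Connects S d
IsSteinerDist⇒Connects ((_ , T , spans) , _) = connects T ℕₚ.≤-refl spans

-- A tree of least size exists only classically; the double negation suffices, as it is used to refute.
¬¬-IsSteinerDist : ∀ {S n} → Connects S n → ¬ ¬ ∃ (IsSteinerDist S)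
¬¬-IsSteinerDist {S} (connects T _ spans) noDist =
  <-rec (λ k → ¬ Spanning k) minimal _ (_ , T , spans)
  where
  Spanning : ℕ → Set
  Spanning k = Σ (List Point) λ V → GridTree V k × All (_∈ V) S
  minimal : ∀ k → (∀ {j} → j < k → ¬ Spanning j) → ¬ Spanning k
  minimal k smaller spanning =
    noDist (k , spanning , λ V j T spans → ℕₚ.≮⇒≥ (λ j<k → smaller j<k (V , T , spans)))

tristance≡halfPerimeter : ∀ {z₁ z₂ z₃ Δ} → IsTristance z₁ z₂ z₃ Δ → Δ ≡ halfPerimeter z₁ z₂ z₃
tristance≡halfPerimeter {z₁} {z₂} {z₃} tri@((_ , T , (z₁∈V ∷ z₂∈V ∷ z₃∈V ∷ [])) , _) =
  ℕₚ.≤-antisym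
    (IsSteinerDist-≤ tri (Connects-mono (xs⊆xs++ys _ (z₁ ∷ [])) ℕₚ.≤-refl
                                        (Connects-rect (InRect-left z₁ z₂) (InRect-left z₁ z₃))))
    (Tripod⇒halfPerimeter≤ (GridTree-tripod T z₁∈V z₂∈V z₃∈V))

InTwoRects : Point → Point → Point → Point → Set
InTwoRects z₁ z₂ z₃ z = (InRect z₁ z₂ z × InRect z₁ z₃ z) ⊎
                        (InRect z₁ z₂ z × InRect z₂ z₃ z) ⊎
                        (InRect z₁ z₃ z × InRect z₂ z₃ z)

InTwoRects? : ∀ z₁ z₂ z₃ z → Dec (InTwoRects z₁ z₂ z₃ z)
InTwoRects? z₁ z₂ z₃ z = (InRect? z₁ z₂ z ×-dec InRect? z₁ z₃ z) ⊎-dec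
                         (InRect? z₁ z₂ z ×-dec InRect? z₂ z₃ z) ⊎-dec
                         (InRect? z₁ z₃ z ×-dec InRect? z₂ z₃ z)

Connects-InTwoRects : ∀ {z₁ z₂ z₃ z} → InTwoRects z₁ z₂ z₃ z →
  Connects (z₁ ∷ z₂ ∷ z₃ ∷ z ∷ []) (halfPerimeter z₁ z₂ z₃)
Connects-InTwoRects (inj₁ (z∈R₁ , z∈R₂)) = Connects-rect z∈R₁ z∈R₂
Connects-InTwoRects {z₁} {z₂} {z₃} (inj₂ (inj₁ (z∈R₁ , z∈R₃))) =
  Connects-mono (⊆-reflexive-↭ (↭-swap z₁ z₂ ↭-refl))
                (ℕₚ.≤-reflexive (halfPerimeter-swap₁₂ z₂ z₁ z₃))
                (Connects-rect (InRect-sym z∈R₁) z∈R₃)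
Connects-InTwoRects {z₁} {z₂} {z₃} {z} (inj₂ (inj₂ (z∈R₂ , z∈R₃))) =
  Connects-mono (⊆-reflexive-↭ (shift z₃ (z₁ ∷ z₂ ∷ []) (z ∷ [])))
                (ℕₚ.≤-reflexive (halfPerimeter-rotate z₃ z₁ z₂))
                (Connects-rect (InRect-sym z∈R₂) (InRect-sym z∈R₃))

HTree-outside : ∀ {k z₁ z₂ z₃ z} → ¬ InTwoRects z₁ z₂ z₃ z → HTree k z₁ z₂ z₃ z →
  halfPerimeter z₁ z₂ z₃ < k
HTree-outside {k} {z₁} {z₂} {z₃} outside (ab∣ce h) = subst (_< k) (halfPerimeter-rotate z₃ z₁ z₂)
  (HShape-outside (λ (z∈R₂ , z∈R₃) → outside (inj₂ (inj₂ (InRect-sym z∈R₂ , InRect-sym z∈R₃))))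
                  (HShape-flip h))
HTree-outside {k} {z₁} {z₂} {z₃} outside (ac∣be h) = subst (_< k) (halfPerimeter-swap₁₂ z₂ z₁ z₃)
  (HShape-outside (λ (z∈R₁ , z∈R₃) → outside (inj₂ (inj₁ (InRect-sym z∈R₁ , z∈R₃))))
                  (HShape-flip h))
HTree-outside outside (ae∣bc h) = HShape-outside (outside ∘ inj₁) h

quadristance-outside : ∀ {z₁ z₂ z₃ z d} → ¬ InTwoRects z₁ z₂ z₃ z →
  IsQuadristance z₁ z₂ z₃ z d → halfPerimeter z₁ z₂ z₃ < d
quadristance-outside outside ((_ , T , (z₁∈V ∷ z₂∈V ∷ z₃∈V ∷ z∈V ∷ [])) , _) =
  HTree-outside outside (GridTree-HTree T z₁∈V z₂∈V z₃∈V z∈V)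

lemma35 : (z₁ z₂ z₃ : Point) → z₁ ≢ z₂ → z₁ ≢ z₃ → z₂ ≢ z₃ →
    (Δ : ℕ) → IsTristance z₁ z₂ z₃ Δ →
    (z : Point) →
      ((d : ℕ) → IsQuadristance z₁ z₂ z₃ z d → d ≤ Δ) ⇔
      ((InRect z₁ z₂ z × InRect z₁ z₃ z) ⊎
       (InRect z₁ z₂ z × InRect z₂ z₃ z) ⊎
       (InRect z₁ z₃ z × InRect z₂ z₃ z))
lemma35 z₁ z₂ z₃ _ _ _ Δ tri z = mk⇔ necessary sufficient
  where
  Δ≡halfPerimeter : Δ ≡ halfPerimeter z₁ z₂ z₃
  Δ≡halfPerimeter = tristance≡halfPerimeter tri

  sufficient : InTwoRects z₁ z₂ z₃ z → (d : ℕ) → IsQuadristance z₁ z₂ z₃ z d → d ≤ Δ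
  sufficient inside d quad =
    subst (d ≤_) (sym Δ≡halfPerimeter) (IsSteinerDist-≤ quad (Connects-InTwoRects inside))

  necessary : ((d : ℕ) → IsQuadristance z₁ z₂ z₃ z d → d ≤ Δ) → InTwoRects z₁ z₂ z₃ z
  necessary bounded with InTwoRects? z₁ z₂ z₃ z
  ... | yes inside = inside
  ... | no outside = ⊥-elim (¬¬-IsSteinerDist spanning λ (d , quad) →
          ℕₚ.<⇒≱ (quadristance-outside outside quad)
                 (subst (d ≤_) Δ≡halfPerimeter (bounded d quad)))
    where
    spanning : Connects (z₁ ∷ z₂ ∷ z₃ ∷ z ∷ []) (Δ + taxicab z₁ z)
    spanning = Connects-mono (⊆-reflexive-↭ (shift z (z₁ ∷ z₂ ∷ z₃ ∷ []) [])) ℕₚ.≤-refl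
                 (Connects-extend (IsSteinerDist⇒Connects tri) (here refl) z)
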